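{- If a stage $(T_\alpha,P_\alpha)$ of the transfinite sequence defined in the context is consistent, then it is sound: for every sentence $\varphi$, it is not the case that both $(\mathbb N,T_\alpha,P_\alpha)\models_{SK}\varphi\vee\neg\varphi$ and $(\mathbb N,T_\alpha,P_\alpha)\models_{SK}\mathscr P(\ulcorner\varphi\urcorner)$.
   Context: $\mathcal L=\mathcal L_{\mathbb N}\cup\{T,P\}$, Tait style (literals $s=t,s\neq t,Tt,\neg Tt,Pt,\neg Pt$; $\wedge,\vee,\forall,\exists$; negation by De Morgan with $\neg\neg\varphi:=\varphi$), fixed Gödel numbering. Interpretations $(T,P)$ with $T=(T^+,T^-)$, $P=(P^+,P^-)\subseteq\omega$; $\models_{SK}$ is Strong Kleene satisfaction in $(\mathbb N,T,P)$ ($Tt$ iff $\mathrm{val}(t)\in T^+$, $\neg Tt$ iff $\mathrm{val}(t)\in T^-$, likewise $P$). $(T,P)$ is consistent iff $T^+\cap T^-=\emptyset$ and $P^+\cap P^-=\emptyset$. $\mathrm{PA}[\mathrm{SK}]$ is Peano arithmetic over the Strong Kleene sequent calculus with identity, induction for all $\mathcal L$-formulas. $B(x)$ is an arithmetical formula representing the set of sentences $\varphi$ with $\mathrm{PA}[\mathrm{SK}]\vdash\varphi\Leftrightarrow\neg T\varphi$ and $\mathrm{PA}[\mathrm{SK}]\vdash\neg\varphi\Leftrightarrow T\varphi$; $\Pi(x):=B(x)\vee B(\neg x)$. $\mathscr P(x)$: $x$ is a sentence and one of: $\Pi(x)$; $x=Ts$ and $P\,\mathrm{val}(s)$; $x=\neg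 Ts$ and $P\,\mathrm{val}(s)$; $x=\psi\wedge\theta$ and $(P\psi\wedge P\theta)\vee(T\psi\wedge P\theta)\vee(T\theta\wedge P\psi)$; $x=\psi\vee\theta$ and $(P\psi\wedge P\theta)\vee(\neg T\psi\wedge P\theta)\vee(\neg T\theta\wedge P\psi)$; $x=\forall v\psi$ and $\exists yP\psi(\dot y)\wedge\forall y(P\psi(\dot y)\vee T\psi(\dot y))$; $x=\exists v\psi$ and $\exists yP\psi(\dot y)\wedge\forall y(P\psi(\dot y)\vee\neg T\psi(\dot y))$ (here $P\psi$ means $P\ulcorner\psi\urcorner$ etc.). $\Gamma_{\mathscr{TP}}(T,P)=\big((\{\#\varphi:\models_{SK}\varphi\},\{\#\varphi:\models_{SK}\neg\varphi\}),(\{\#\varphi:\models_{SK}\mathscr P(\ulcorner\varphi\urcorner)\},\{\#\varphi:\models_{SK}\varphi\vee\neg\varphi\})\big)$, satisfaction in $(\mathbb N,T,P)$. Sequence: $(T_0,P_0)=((\emptyset,\emptyset),(\emptyset,\emptyset))$, $(T_{\beta+1},P_{\beta+1})=\Gamma_{\mathscr{TP}}(T_\beta,P_\beta)$, componentwise unions at limits. -}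

module Defs where

open import Data.Nat using (ℕ; zero; suc; _+_; _*_; _^_)
open import Data.Fin using (Fin; toℕ) renaming (zero to fz; suc to fs)
open import Data.List using (List; []; _∷_; map)
open import Data.List.Relation.Binary.Permutation.Propositional using (_↭_)
open import Data.Product using (Σ; _×_)
open import Data.Sum using (_⊎_)
open import Data.Empty using (⊥)
open import Relation.Nullary using (¬_)
open import Relation.Binary.PropositionalEquality using (_≡_)

-- Syntax of L = L_N ∪ {T, P}, Tait style, de Bruijn variables.
-- L_N has 0, S, +, × (and identity).

infixl 7 _*'_
infixl 6 _+'_

data Tm (n : ℕ) : Set where
  var  : Fin n → Tm n
  zer  : Tm n
  suc' : Tm n → Tm n
  _+'_ : Tm n → Tm n → Tm n
  _*'_ : Tm n → Tm n → Tm n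

infixr 4 _∧'_
infixr 3 _∨'_

data Fm (n : ℕ) : Set where
  eq neq       : Tm n → Tm n → Fm n
  tr ntr       : Tm n → Fm n
  pr npr       : Tm n → Fm n
  _∧'_ _∨'_    : Fm n → Fm n → Fm n
  all' ex'     : Fm (suc n) → Fm n

Sentence : Set
Sentence = Fm 0

neg : ∀ {n} → Fm n → Fm n
neg (eq s t) = neq s t
neg (neq s t) = eq s t
neg (tr t) = ntr t
neg (ntr t) = tr t
neg (pr t) = npr t
neg (npr t) = pr t
neg (φ ∧' ψ) = neg φ ∨' neg ψ
neg (φ ∨' ψ) = neg φ ∧' neg ψ
neg (all' φ) = ex' (neg φ)
neg (ex' φ) = all' (neg φ)

Subst : ℕ → ℕ → Set
Subst n m = Fin n → Tm m

tsub : ∀ {n m} → Subst n m → Tm n → Tm m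
tsub σ (var i) = σ i
tsub σ zer = zer
tsub σ (suc' t) = suc' (tsub σ t)
tsub σ (s +' t) = tsub σ s +' tsub σ t
tsub σ (s *' t) = tsub σ s *' tsub σ t

lift : ∀ {n m} → Subst n m → Subst (suc n) (suc m)
lift σ fz = var fz
lift σ (fs i) = tsub (λ j → var (fs j)) (σ i)

fsub : ∀ {n m} → Subst n m → Fm n → Fm m
fsub σ (eq s t) = eq (tsub σ s) (tsub σ t)
fsub σ (neq s t) = neq (tsub σ s) (tsub σ t)
fsub σ (tr t) = tr (tsub σ t)
fsub σ (ntr t) = ntr (tsub σ t)
fsub σ (pr t) = pr (tsub σ t)
fsub σ (npr t) = npr (tsub σ t)
fsub σ (φ ∧' ψ) = fsub σ φ ∧' fsub σ ψ
fsub σ (φ ∨' ψ) = fsub σ φ ∨' fsub σ ψ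
fsub σ (all' φ) = all' (fsub (lift σ) φ)
fsub σ (ex' φ) = ex' (fsub (lift σ) φ)

wk : ∀ {n} → Fm n → Fm (suc n)
wk = fsub (λ j → var (fs j))

single : ∀ {n} → Tm n → Subst (suc n) n
single t fz = t
single t (fs i) = var i

inst : ∀ {n} → Fm (suc n) → Tm n → Fm n
inst φ t = fsub (single t) φ

inst0 : ∀ {n} → Fm (suc n) → Tm (suc n) → Fm (suc n)
inst0 φ u = fsub (λ { fz → u ; (fs i) → var (fs i) }) φ

num : ∀ {n} → ℕ → Tm n
num zero = zer
num (suc k) = suc' (num k)

-- A fixed Gödel numbering (injective, via  ⟨a , b⟩ = 2^a (2b+1))

pair : ℕ → ℕ → ℕ
pair a b = (2 ^ a) * (2 * b + 1)

codeT : ∀ {n} → Tm n → ℕ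
codeT (var i) = pair 0 (toℕ i)
codeT zer = pair 1 0
codeT (suc' t) = pair 2 (codeT t)
codeT (s +' t) = pair 3 (pair (codeT s) (codeT t))
codeT (s *' t) = pair 4 (pair (codeT s) (codeT t))

code : ∀ {n} → Fm n → ℕ
code (eq s t) = pair 0 (pair (codeT s) (codeT t))
code (neq s t) = pair 1 (pair (codeT s) (codeT t))
code (tr t) = pair 2 (codeT t)
code (ntr t) = pair 3 (codeT t)
code (pr t) = pair 4 (codeT t)
code (npr t) = pair 5 (codeT t)
code (φ ∧' ψ) = pair 6 (pair (code φ) (code ψ))
code (φ ∨' ψ) = pair 7 (pair (code φ) (code ψ))
code (all' φ) = pair 8 (code φ)
code (ex' φ) = pair 9 (code φ)

⌜_⌝ : ∀ {n m} → Fm n → Tm m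
⌜ φ ⌝ = num (code φ)

-- PA[SK]: Peano arithmetic over a Strong Kleene (K3) two-sided
-- sequent calculus with identity; induction for all L-formulas.

infix 2 _⊢_

data _⊢_ {n : ℕ} : List (Fm n) → List (Fm n) → Set where
  ax    : ∀ {φ} → φ ∷ [] ⊢ φ ∷ []
  wkL   : ∀ {Γ Δ φ} → Γ ⊢ Δ → φ ∷ Γ ⊢ Δ
  wkR   : ∀ {Γ Δ φ} → Γ ⊢ Δ → Γ ⊢ φ ∷ Δ
  ctL   : ∀ {Γ Δ φ} → φ ∷ φ ∷ Γ ⊢ Δ → φ ∷ Γ ⊢ Δ
  ctR   : ∀ {Γ Δ φ} → Γ ⊢ φ ∷ φ ∷ Δ → Γ ⊢ φ ∷ Δ
  pmL   : ∀ {Γ Γ' Δ} → Γ ↭ Γ' → Γ ⊢ Δ → Γ' ⊢ Δ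
  pmR   : ∀ {Γ Δ Δ'} → Δ ↭ Δ' → Γ ⊢ Δ → Γ ⊢ Δ'
  cut   : ∀ {Γ Δ φ} → Γ ⊢ φ ∷ Δ → φ ∷ Γ ⊢ Δ → Γ ⊢ Δ
  -- literal rules (K3: explosion for all literals,
  -- excluded middle only for arithmetical literals)
  exEq  : ∀ {s t} → eq s t ∷ neq s t ∷ [] ⊢ []
  exT   : ∀ {t} → tr t ∷ ntr t ∷ [] ⊢ []
  exP   : ∀ {t} → pr t ∷ npr t ∷ [] ⊢ []
  emEq  : ∀ {s t} → [] ⊢ eq s t ∷ neq s t ∷ []
  ∧L    : ∀ {Γ Δ φ ψ} → φ ∷ ψ ∷ Γ ⊢ Δ → (φ ∧' ψ) ∷ Γ ⊢ Δ
  ∧R    : ∀ {Γ Δ φ ψ} → Γ ⊢ φ ∷ Δ → Γ ⊢ ψ ∷ Δ → Γ ⊢ (φ ∧' ψ) ∷ Δ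
  ∨L    : ∀ {Γ Δ φ ψ} → φ ∷ Γ ⊢ Δ → ψ ∷ Γ ⊢ Δ → (φ ∨' ψ) ∷ Γ ⊢ Δ
  ∨R    : ∀ {Γ Δ φ ψ} → Γ ⊢ φ ∷ ψ ∷ Δ → Γ ⊢ (φ ∨' ψ) ∷ Δ
  ∀L    : ∀ {Γ Δ φ} (t : Tm n) → inst φ t ∷ Γ ⊢ Δ → all' φ ∷ Γ ⊢ Δ
  ∀R    : ∀ {Γ Δ φ} → map wk Γ ⊢ φ ∷ map wk Δ → Γ ⊢ all' φ ∷ Δ
  ∃L    : ∀ {Γ Δ φ} → φ ∷ map wk Γ ⊢ map wk Δ → ex' φ ∷ Γ ⊢ Δ
  ∃R    : ∀ {Γ Δ φ} (t : Tm n) → Γ ⊢ inst φ t ∷ Δ → Γ ⊢ ex' φ ∷ Δ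
  refl= : ∀ {t} → [] ⊢ eq t t ∷ []
  subst= : ∀ {s t} (φ : Fm (suc n)) → eq s t ∷ inst φ s ∷ [] ⊢ inst φ t ∷ []
  pa1   : ∀ {t} → eq (suc' t) zer ∷ [] ⊢ []
  pa2   : ∀ {s t} → eq (suc' s) (suc' t) ∷ [] ⊢ eq s t ∷ []
  pa3   : ∀ {s} → [] ⊢ eq (s +' zer) s ∷ []
  pa4   : ∀ {s t} → [] ⊢ eq (s +' suc' t) (suc' (s +' t)) ∷ []
  pa5   : ∀ {s} → [] ⊢ eq (s *' zer) zer ∷ []
  pa6   : ∀ {s t} → [] ⊢ eq (s *' suc' t) ((s *' t) +' s) ∷ []
  ind   : ∀ {Γ Δ} (φ : Fm (suc n)) (t : Tm n) →
          φ ∷ map wk Γ ⊢ inst0 φ (suc' (var fz)) ∷ map wk Δ →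
          inst φ zer ∷ Γ ⊢ inst φ t ∷ Δ

_⇔_ : Sentence → Sentence → Set
φ ⇔ ψ = (φ ∷ [] ⊢ ψ ∷ []) × (ψ ∷ [] ⊢ φ ∷ [])

InB : Sentence → Set
InB φ = (φ ⇔ ntr ⌜ φ ⌝) × (neg φ ⇔ tr ⌜ φ ⌝)

-- Π(x) := B(x) ∨ B(¬x)  (truth in N of the arithmetical formula)
InΠ : Sentence → Set
InΠ φ = InB φ ⊎ InB (neg φ)

record Interp : Set₁ where
  field
    T⁺ T⁻ P⁺ P⁻ : ℕ → Set
open Interp public

Consistent : Interp → Set
Consistent I = (∀ k → ¬ (T⁺ I k × T⁻ I k)) × (∀ k → ¬ (P⁺ I k × P⁻ I k))

Env : ℕ → Set
Env n = Fin n → ℕ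

ext : ∀ {n} → ℕ → Env n → Env (suc n)
ext k ρ fz = k
ext k ρ (fs i) = ρ i

val : ∀ {n} → Env n → Tm n → ℕ
val ρ (var i) = ρ i
val ρ zer = zero
val ρ (suc' t) = suc (val ρ t)
val ρ (s +' t) = val ρ s + val ρ t
val ρ (s *' t) = val ρ s * val ρ t

SatE : ∀ {n} → Interp → Env n → Fm n → Set
SatE I ρ (eq s t) = val ρ s ≡ val ρ t
SatE I ρ (neq s t) = ¬ (val ρ s ≡ val ρ t)
SatE I ρ (tr t) = T⁺ I (val ρ t)
SatE I ρ (ntr t) = T⁻ I (val ρ t)
SatE I ρ (pr t) = P⁺ I (val ρ t)
SatE I ρ (npr t) = P⁻ I (val ρ t)
SatE I ρ (φ ∧' ψ) = SatE I ρ φ × SatE I ρ ψ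
SatE I ρ (φ ∨' ψ) = SatE I ρ φ ⊎ SatE I ρ ψ
SatE I ρ (all' φ) = ∀ k → SatE I (ext k ρ) φ
SatE I ρ (ex' φ) = Σ ℕ (λ k → SatE I (ext k ρ) φ)

emptyEnv : Env 0
emptyEnv ()

_⊨_ : Interp → Sentence → Set
I ⊨ φ = SatE I emptyEnv φ

_⟨_⟩ : Fm 1 → ℕ → Sentence
ψ ⟨ y ⟩ = inst ψ (num y)

-- Strong Kleene truth of 𝒫(⌜φ⌝) in (N, T, P), written out clause by clause
-- (the arithmetical parts evaluated classically).
𝒫-clause : Interp → Sentence → Set
𝒫-clause I (tr s) = P⁺ I (val emptyEnv s)
𝒫-clause I (ntr s) = P⁺ I (val emptyEnv s)
𝒫-clause I (ψ ∧' θ) =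
  (P⁺ I (code ψ) × P⁺ I (code θ)) ⊎
  (T⁺ I (code ψ) × P⁺ I (code θ)) ⊎
  (T⁺ I (code θ) × P⁺ I (code ψ))
𝒫-clause I (ψ ∨' θ) =
  (P⁺ I (code ψ) × P⁺ I (code θ)) ⊎
  (T⁻ I (code ψ) × P⁺ I (code θ)) ⊎
  (T⁻ I (code θ) × P⁺ I (code ψ))
𝒫-clause I (all' ψ) =
  Σ ℕ (λ y → P⁺ I (code (ψ ⟨ y ⟩))) ×
  (∀ y → P⁺ I (code (ψ ⟨ y ⟩)) ⊎ T⁺ I (code (ψ ⟨ y ⟩)))
𝒫-clause I (ex' ψ) =
  Σ ℕ (λ y → P⁺ I (code (ψ ⟨ y ⟩))) ×
  (∀ y → P⁺ I (code (ψ ⟨ y ⟩)) ⊎ T⁻ I (code (ψ ⟨ y ⟩)))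
𝒫-clause I _ = ⊥

Sat𝒫 : Interp → Sentence → Set
Sat𝒫 I φ = InΠ φ ⊎ 𝒫-clause I φ

ΓTP : Interp → Interp
T⁺ (ΓTP I) k = Σ Sentence (λ φ → (code φ ≡ k) × (I ⊨ φ))
T⁻ (ΓTP I) k = Σ Sentence (λ φ → (code φ ≡ k) × (I ⊨ neg φ))
P⁺ (ΓTP I) k = Σ Sentence (λ φ → (code φ ≡ k) × Sat𝒫 I φ)
P⁻ (ΓTP I) k = Σ Sentence (λ φ → (code φ ≡ k) × (I ⊨ (φ ∨' neg φ)))

-- Brouwer-style ordinal notations with limits over arbitrary index types
data Ord : Set₁ where
  ozero : Ord
  osuc  : Ord → Ord
  olim  : (I : Set) → (I → Ord) → Ord

emptyI : Interp
T⁺ emptyI _ = ⊥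
T⁻ emptyI _ = ⊥
P⁺ emptyI _ = ⊥
P⁻ emptyI _ = ⊥

stage : Ord → Interp
stage ozero = emptyI
stage (osuc α) = ΓTP (stage α)
T⁺ (stage (olim I f)) k = Σ I (λ i → T⁺ (stage (f i)) k)
T⁻ (stage (olim I f)) k = Σ I (λ i → T⁻ (stage (f i)) k)
P⁺ (stage (olim I f)) k = Σ I (λ i → P⁺ (stage (f i)) k)
P⁻ (stage (olim I f)) k = Σ I (λ i → P⁻ (stage (f i)) k)

{-# OPTIONS --safe #-}
module Submission where

-- Let u be a consistent stage. Two invariants hold at every stage: u ⊑ ΓTP u, so that
-- ⌜ψ⌝ in T⁺, T⁻, P⁺ of u yields u ⊨ ψ, u ⊨ ¬ψ, 𝒫(ψ) in u; and T⁺ ∪ T⁻ ⊆ P⁻.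
-- By induction on the size of φ, no φ is both determinate and in 𝒫.  For φ = Tt or ¬Tt,
-- determinacy puts val t into T⁺ ∪ T⁻ ⊆ P⁻ while 𝒫 puts it into P⁺, against consistency.
-- For compound φ, each disjunct of 𝒫(φ) puts some component (or instance) into P⁺ and
-- every other one into P⁺ or into T with the value that does not settle φ; so a
-- determinate φ has either a determinate component in P⁺ (induction hypothesis) or a
-- component whose value recorded in T is refuted (consistency).  Sentences in Π are
-- undetermined: B(φ) makes φ provably imply ¬T⌜φ⌝, so if φ held then ⌜φ⌝ ∈ T⁻ and ¬φ
-- would hold too, and symmetrically for ¬φ; this uses soundness of PA[SK] for
-- consistent interpretations.

open import Defs
open import Data.Nat using (ℕ; zero; suc; _+_; _*_; _^_; _<_; _≟_; s≤s)
open import Data.Nat.Properties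
  using ( suc-injective; +-comm; +-suc; +-identityʳ; *-suc; *-zeroʳ; *-identityˡ; *-assoc
        ; *-cancelˡ-≡; even≢odd; m≤m+n; m≤n+m; ≤-reflexive)
open import Data.Nat.Induction using (<-wellFounded)
open import Induction.WellFounded using (Acc; acc)
open import Data.Fin using (toℕ) renaming (zero to fz; suc to fs)
open import Data.Fin.Properties using (toℕ-injective)
open import Data.List using (List; []; _∷_; map)
open import Data.List.Relation.Unary.All using (All; []; _∷_)
import Data.List.Relation.Unary.All as All
open import Data.List.Relation.Unary.All.Properties using (map⁺)
open import Data.List.Relation.Binary.Permutation.Propositional using (↭-sym)
open import Data.List.Relation.Binary.Permutation.Propositional.Properties using (All-resp-↭)
open import Data.Product using (Σ; _×_; _,_; proj₁; proj₂; uncurry)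
import Data.Product as Product
open import Data.Sum using (_⊎_; inj₁; inj₂; [_,_])
import Data.Sum as Sum
open import Data.Empty using (⊥-elim)
open import Function using (id; _∘_)
open import Relation.Nullary using (¬_)
open import Relation.Nullary.Negation
  using (DoubleNegation; Stable; ¬¬-map; negated-stable; contradiction)
open import Relation.Nullary.Decidable using (decidable-stable)
open import Relation.Binary.PropositionalEquality
  using (_≡_; refl; sym; trans; cong; cong₂; subst; subst₂)

pair-zero : ∀ b → pair 0 b ≡ suc (2 * b)
pair-zero b = trans (*-identityˡ (2 * b + 1)) (+-comm (2 * b) 1)

pair-suc : ∀ a b → pair (suc a) b ≡ 2 * pair a b
pair-suc a b = *-assoc 2 (2 ^ a) (2 * b + 1)

pair-injective : ∀ {a b c d} → pair a b ≡ pair c d → a ≡ c × b ≡ d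
pair-injective {zero} {b} {zero} {d} e =
  refl , *-cancelˡ-≡ b d 2 (suc-injective (trans (sym (pair-zero b)) (trans e (pair-zero d))))
pair-injective {zero} {b} {suc c} {d} e =
  ⊥-elim (even≢odd (pair c d) b (trans (sym (pair-suc c d)) (trans (sym e) (pair-zero b))))
pair-injective {suc a} {b} {zero} {d} e =
  ⊥-elim (even≢odd (pair a b) d (trans (sym (pair-suc a b)) (trans e (pair-zero d))))
pair-injective {suc a} {b} {suc c} {d} e =
  Product.map₁ (cong suc)
    (pair-injective (*-cancelˡ-≡ (pair a b) (pair c d) 2
      (trans (sym (pair-suc a b)) (trans e (pair-suc c d)))))

splitT : ∀ {n} → Tm n → ℕ × ℕ
splitT (var i) = 0 , toℕ i
splitT zer = 1 , 0
splitT (suc' t) = 2 , codeT t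
splitT (s +' t) = 3 , pair (codeT s) (codeT t)
splitT (s *' t) = 4 , pair (codeT s) (codeT t)

codeT-split : ∀ {n} (t : Tm n) → codeT t ≡ uncurry pair (splitT t)
codeT-split (var i) = refl
codeT-split zer = refl
codeT-split (suc' t) = refl
codeT-split (s +' t) = refl
codeT-split (s *' t) = refl

split : ∀ {n} → Fm n → ℕ × ℕ
split (eq s t) = 0 , pair (codeT s) (codeT t)
split (neq s t) = 1 , pair (codeT s) (codeT t)
split (tr t) = 2 , codeT t
split (ntr t) = 3 , codeT t
split (pr t) = 4 , codeT t
split (npr t) = 5 , codeT t
split (φ ∧' ψ) = 6 , pair (code φ) (code ψ)
split (φ ∨' ψ) = 7 , pair (code φ) (code ψ)
split (all' φ) = 8 , code φ
split (ex' φ) = 9 , code φ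

code-split : ∀ {n} (φ : Fm n) → code φ ≡ uncurry pair (split φ)
code-split (eq s t) = refl
code-split (neq s t) = refl
code-split (tr t) = refl
code-split (ntr t) = refl
code-split (pr t) = refl
code-split (npr t) = refl
code-split (φ ∧' ψ) = refl
code-split (φ ∨' ψ) = refl
code-split (all' φ) = refl
code-split (ex' φ) = refl

-- Clauses with different head constructors are missing on purpose: there the tag
-- equation is refuted by unification.
mutual
  codeT-injective : ∀ {n} {s t : Tm n} → codeT s ≡ codeT t → s ≡ t
  codeT-injective {s = s} {t} e =
    uncurry (splitT-injective s t)
      (pair-injective (trans (sym (codeT-split s)) (trans e (codeT-split t))))

  splitT-injective : ∀ {n} (s t : Tm n) → proj₁ (splitT s) ≡ proj₁ (splitT t) →
                     proj₂ (splitT s) ≡ proj₂ (splitT t) → s ≡ t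
  splitT-injective (var i) (var j) refl e = cong var (toℕ-injective e)
  splitT-injective zer zer refl e = refl
  splitT-injective (suc' s) (suc' t) refl e = cong suc' (codeT-injective e)
  splitT-injective (s +' t) (s′ +' t′) refl e =
    uncurry (cong₂ _+'_) (Product.map codeT-injective codeT-injective (pair-injective e))
  splitT-injective (s *' t) (s′ *' t′) refl e =
    uncurry (cong₂ _*'_) (Product.map codeT-injective codeT-injective (pair-injective e))

mutual
  code-injective : ∀ {n} {φ ψ : Fm n} → code φ ≡ code ψ → φ ≡ ψ
  code-injective {φ = φ} {ψ} e =
    uncurry (split-injective φ ψ)
      (pair-injective (trans (sym (code-split φ)) (trans e (code-split ψ))))

  split-injective : ∀ {n} (φ ψ : Fm n) → proj₁ (split φ) ≡ proj₁ (split ψ) →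
                    proj₂ (split φ) ≡ proj₂ (split ψ) → φ ≡ ψ
  split-injective (eq s t) (eq s′ t′) refl e =
    uncurry (cong₂ eq) (Product.map codeT-injective codeT-injective (pair-injective e))
  split-injective (neq s t) (neq s′ t′) refl e =
    uncurry (cong₂ neq) (Product.map codeT-injective codeT-injective (pair-injective e))
  split-injective (tr t) (tr t′) refl e = cong tr (codeT-injective e)
  split-injective (ntr t) (ntr t′) refl e = cong ntr (codeT-injective e)
  split-injective (pr t) (pr t′) refl e = cong pr (codeT-injective e)
  split-injective (npr t) (npr t′) refl e = cong npr (codeT-injective e)
  split-injective (φ ∧' ψ) (φ′ ∧' ψ′) refl e =
    uncurry (cong₂ _∧'_) (Product.map code-injective code-injective (pair-injective e))
  split-injective (φ ∨' ψ) (φ′ ∨' ψ′) refl e =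
    uncurry (cong₂ _∨'_) (Product.map code-injective code-injective (pair-injective e))
  split-injective (all' φ) (all' φ′) refl e = cong all' (code-injective e)
  split-injective (ex' φ) (ex' φ′) refl e = cong ex' (code-injective e)

size : ∀ {n} → Fm n → ℕ
size (φ ∧' ψ) = suc (size φ + size ψ)
size (φ ∨' ψ) = suc (size φ + size ψ)
size (all' φ) = suc (size φ)
size (ex' φ) = suc (size φ)
size _ = zero

size-fsub : ∀ {n m} (σ : Subst n m) (φ : Fm n) → size (fsub σ φ) ≡ size φ
size-fsub σ (eq s t) = refl
size-fsub σ (neq s t) = refl
size-fsub σ (tr t) = refl
size-fsub σ (ntr t) = refl
size-fsub σ (pr t) = refl
size-fsub σ (npr t) = refl
size-fsub σ (φ ∧' ψ) = cong₂ (λ a b → suc (a + b)) (size-fsub σ φ) (size-fsub σ ψ)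
size-fsub σ (φ ∨' ψ) = cong₂ (λ a b → suc (a + b)) (size-fsub σ φ) (size-fsub σ ψ)
size-fsub σ (all' φ) = cong suc (size-fsub (lift σ) φ)
size-fsub σ (ex' φ) = cong suc (size-fsub (lift σ) φ)

size<ˡ : ∀ {n} (ψ θ : Fm n) → size ψ < suc (size ψ + size θ)
size<ˡ ψ θ = s≤s (m≤m+n (size ψ) (size θ))

size<ʳ : ∀ {n} (ψ θ : Fm n) → size θ < suc (size ψ + size θ)
size<ʳ ψ θ = s≤s (m≤n+m (size θ) (size ψ))

size-inst< : ∀ (ψ : Fm 1) y → size (ψ ⟨ y ⟩) < suc (size ψ)
size-inst< ψ y = s≤s (≤-reflexive (size-fsub (single (num y)) ψ))

neg-involutive : ∀ {n} (φ : Fm n) → neg (neg φ) ≡ φ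
neg-involutive (eq s t) = refl
neg-involutive (neq s t) = refl
neg-involutive (tr t) = refl
neg-involutive (ntr t) = refl
neg-involutive (pr t) = refl
neg-involutive (npr t) = refl
neg-involutive (φ ∧' ψ) = cong₂ _∧'_ (neg-involutive φ) (neg-involutive ψ)
neg-involutive (φ ∨' ψ) = cong₂ _∨'_ (neg-involutive φ) (neg-involutive ψ)
neg-involutive (all' φ) = cong all' (neg-involutive φ)
neg-involutive (ex' φ) = cong ex' (neg-involutive φ)

fsub-neg : ∀ {n m} (σ : Subst n m) (φ : Fm n) → fsub σ (neg φ) ≡ neg (fsub σ φ)
fsub-neg σ (eq s t) = refl
fsub-neg σ (neq s t) = refl
fsub-neg σ (tr t) = refl
fsub-neg σ (ntr t) = refl
fsub-neg σ (pr t) = refl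
fsub-neg σ (npr t) = refl
fsub-neg σ (φ ∧' ψ) = cong₂ _∨'_ (fsub-neg σ φ) (fsub-neg σ ψ)
fsub-neg σ (φ ∨' ψ) = cong₂ _∧'_ (fsub-neg σ φ) (fsub-neg σ ψ)
fsub-neg σ (all' φ) = cong ex' (fsub-neg (lift σ) φ)
fsub-neg σ (ex' φ) = cong all' (fsub-neg (lift σ) φ)

val-num : ∀ {n} (ρ : Env n) k → val ρ (num k) ≡ k
val-num ρ zero = refl
val-num ρ (suc k) = cong suc (val-num ρ k)

Agree : ∀ {n m} → Subst n m → Env m → Env n → Set
Agree σ ρ ρ′ = ∀ i → val ρ (σ i) ≡ ρ′ i

val-tsub : ∀ {n m} {σ : Subst n m} {ρ ρ′} → Agree σ ρ ρ′ → ∀ t → val ρ (tsub σ t) ≡ val ρ′ t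
val-tsub a (var i) = a i
val-tsub a zer = refl
val-tsub a (suc' t) = cong suc (val-tsub a t)
val-tsub a (s +' t) = cong₂ _+_ (val-tsub a s) (val-tsub a t)
val-tsub a (s *' t) = cong₂ _*_ (val-tsub a s) (val-tsub a t)

Agree-wk : ∀ {n} {ρ : Env n} k → Agree (λ j → var (fs j)) (ext k ρ) ρ
Agree-wk k i = refl

Agree-lift : ∀ {n m} {σ : Subst n m} {ρ ρ′} → Agree σ ρ ρ′ →
             ∀ k → Agree (lift σ) (ext k ρ) (ext k ρ′)
Agree-lift a k fz = refl
Agree-lift {σ = σ} a k (fs i) = trans (val-tsub (Agree-wk k) (σ i)) (a i)

Agree-single : ∀ {n} {ρ : Env n} {t k} → val ρ t ≡ k → Agree (single t) ρ (ext k ρ)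
Agree-single e fz = e
Agree-single e (fs i) = refl

⊨-fsub : ∀ {n m} {I} {σ : Subst n m} {ρ ρ′} → Agree σ ρ ρ′ →
         ∀ φ → SatE I ρ′ φ → SatE I ρ (fsub σ φ)
⊨-fsub a (eq s t) = subst₂ _≡_ (sym (val-tsub a s)) (sym (val-tsub a t))
⊨-fsub a (neq s t) x = x ∘ subst₂ _≡_ (val-tsub a s) (val-tsub a t)
⊨-fsub {I = I} a (tr t) = subst (T⁺ I) (sym (val-tsub a t))
⊨-fsub {I = I} a (ntr t) = subst (T⁻ I) (sym (val-tsub a t))
⊨-fsub {I = I} a (pr t) = subst (P⁺ I) (sym (val-tsub a t))
⊨-fsub {I = I} a (npr t) = subst (P⁻ I) (sym (val-tsub a t))
⊨-fsub a (φ ∧' ψ) = Product.map (⊨-fsub a φ) (⊨-fsub a ψ)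
⊨-fsub a (φ ∨' ψ) = Sum.map (⊨-fsub a φ) (⊨-fsub a ψ)
⊨-fsub a (all' φ) f k = ⊨-fsub (Agree-lift a k) φ (f k)
⊨-fsub a (ex' φ) (k , x) = k , ⊨-fsub (Agree-lift a k) φ x

⊨-inst : ∀ {I} (ψ : Fm 1) k → SatE I (ext k emptyEnv) ψ → I ⊨ (ψ ⟨ k ⟩)
⊨-inst ψ k = ⊨-fsub (Agree-single (val-num emptyEnv k)) ψ

⊨-inst-neg : ∀ {I} (ψ : Fm 1) k → SatE I (ext k emptyEnv) (neg ψ) → I ⊨ neg (ψ ⟨ k ⟩)
⊨-inst-neg {I} ψ k x = subst (I ⊨_) (fsub-neg (single (num k)) ψ) (⊨-inst (neg ψ) k x)

⊨-consistent : ∀ {I} → Consistent I → ∀ {n} (ρ : Env n) φ → SatE I ρ φ → ¬ SatE I ρ (neg φ)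
⊨-consistent c ρ (eq s t) x y = y x
⊨-consistent c ρ (neq s t) x y = x y
⊨-consistent c ρ (tr t) x y = proj₁ c _ (x , y)
⊨-consistent c ρ (ntr t) x y = proj₁ c _ (y , x)
⊨-consistent c ρ (pr t) x y = proj₂ c _ (x , y)
⊨-consistent c ρ (npr t) x y = proj₂ c _ (y , x)
⊨-consistent c ρ (φ ∧' ψ) (x , _) (inj₁ y) = ⊨-consistent c ρ φ x y
⊨-consistent c ρ (φ ∧' ψ) (_ , x) (inj₂ y) = ⊨-consistent c ρ ψ x y
⊨-consistent c ρ (φ ∨' ψ) (inj₁ x) (y , _) = ⊨-consistent c ρ φ x y
⊨-consistent c ρ (φ ∨' ψ) (inj₂ x) (_ , y) = ⊨-consistent c ρ ψ x y
⊨-consistent c ρ (all' φ) f (k , y) = ⊨-consistent c (ext k ρ) φ (f k) y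
⊨-consistent c ρ (ex' φ) (k , x) f = ⊨-consistent c (ext k ρ) φ x (f k)

Determinate : Interp → Sentence → Set
Determinate I φ = I ⊨ (φ ∨' neg φ)

Determinate-neg : ∀ {I} φ → Determinate I φ → Determinate I (neg φ)
Determinate-neg {I} φ d = subst (λ χ → I ⊨ (neg φ ∨' χ)) (sym (neg-involutive φ)) (Sum.swap d)

-- PA[SK] proves s = t ∨ s ≠ t and has the ∀-right rule, so it is sound only classically.
-- Its soundness is proved for this double-negation reading of Strong Kleene satisfaction,
-- which is stable and implied by the real one.
Sat¬¬ : ∀ {n} → Interp → Env n → Fm n → Set
Sat¬¬ I ρ (eq s t) = val ρ s ≡ val ρ t
Sat¬¬ I ρ (neq s t) = ¬ (val ρ s ≡ val ρ t)
Sat¬¬ I ρ (tr t) = DoubleNegation (T⁺ I (val ρ t))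
Sat¬¬ I ρ (ntr t) = DoubleNegation (T⁻ I (val ρ t))
Sat¬¬ I ρ (pr t) = DoubleNegation (P⁺ I (val ρ t))
Sat¬¬ I ρ (npr t) = DoubleNegation (P⁻ I (val ρ t))
Sat¬¬ I ρ (φ ∧' ψ) = Sat¬¬ I ρ φ × Sat¬¬ I ρ ψ
Sat¬¬ I ρ (φ ∨' ψ) = DoubleNegation (Sat¬¬ I ρ φ ⊎ Sat¬¬ I ρ ψ)
Sat¬¬ I ρ (all' φ) = ∀ k → Sat¬¬ I (ext k ρ) φ
Sat¬¬ I ρ (ex' φ) = DoubleNegation (Σ ℕ λ k → Sat¬¬ I (ext k ρ) φ)

Sat¬¬-stable : ∀ {n} I (ρ : Env n) φ → Stable (Sat¬¬ I ρ φ)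
Sat¬¬-stable I ρ (eq s t) = decidable-stable (val ρ s ≟ val ρ t)
Sat¬¬-stable I ρ (neq s t) = negated-stable
Sat¬¬-stable I ρ (tr t) = negated-stable
Sat¬¬-stable I ρ (ntr t) = negated-stable
Sat¬¬-stable I ρ (pr t) = negated-stable
Sat¬¬-stable I ρ (npr t) = negated-stable
Sat¬¬-stable I ρ (φ ∧' ψ) x =
  Sat¬¬-stable I ρ φ (¬¬-map proj₁ x) , Sat¬¬-stable I ρ ψ (¬¬-map proj₂ x)
Sat¬¬-stable I ρ (φ ∨' ψ) = negated-stable
Sat¬¬-stable I ρ (all' φ) x k = Sat¬¬-stable I (ext k ρ) φ (¬¬-map (λ f → f k) x)
Sat¬¬-stable I ρ (ex' φ) = negated-stable

SatE⇒Sat¬¬ : ∀ {n I} {ρ : Env n} φ → SatE I ρ φ → Sat¬¬ I ρ φ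
SatE⇒Sat¬¬ (eq s t) x = x
SatE⇒Sat¬¬ (neq s t) x = x
SatE⇒Sat¬¬ (tr t) x = contradiction x
SatE⇒Sat¬¬ (ntr t) x = contradiction x
SatE⇒Sat¬¬ (pr t) x = contradiction x
SatE⇒Sat¬¬ (npr t) x = contradiction x
SatE⇒Sat¬¬ (φ ∧' ψ) = Product.map (SatE⇒Sat¬¬ φ) (SatE⇒Sat¬¬ ψ)
SatE⇒Sat¬¬ (φ ∨' ψ) x = contradiction (Sum.map (SatE⇒Sat¬¬ φ) (SatE⇒Sat¬¬ ψ) x)
SatE⇒Sat¬¬ (all' φ) f k = SatE⇒Sat¬¬ φ (f k)
SatE⇒Sat¬¬ (ex' φ) (k , x) = contradiction (k , SatE⇒Sat¬¬ φ x)

subst-iff : ∀ (P : ℕ → Set) {x y} → x ≡ y → (P y → P x) × (P x → P y)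
subst-iff P e = subst P (sym e) , subst P e

Sat¬¬-fsub : ∀ {n m} {I} {σ : Subst n m} {ρ ρ′} → Agree σ ρ ρ′ → ∀ φ →
             (Sat¬¬ I ρ′ φ → Sat¬¬ I ρ (fsub σ φ)) × (Sat¬¬ I ρ (fsub σ φ) → Sat¬¬ I ρ′ φ)
Sat¬¬-fsub a (eq s t) =
  subst₂ _≡_ (sym (val-tsub a s)) (sym (val-tsub a t)) , subst₂ _≡_ (val-tsub a s) (val-tsub a t)
Sat¬¬-fsub a (neq s t) =
  (_∘ subst₂ _≡_ (val-tsub a s) (val-tsub a t)) ,
  (_∘ subst₂ _≡_ (sym (val-tsub a s)) (sym (val-tsub a t)))
Sat¬¬-fsub {I = I} a (tr t) = subst-iff (DoubleNegation ∘ T⁺ I) (val-tsub a t)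
Sat¬¬-fsub {I = I} a (ntr t) = subst-iff (DoubleNegation ∘ T⁻ I) (val-tsub a t)
Sat¬¬-fsub {I = I} a (pr t) = subst-iff (DoubleNegation ∘ P⁺ I) (val-tsub a t)
Sat¬¬-fsub {I = I} a (npr t) = subst-iff (DoubleNegation ∘ P⁻ I) (val-tsub a t)
Sat¬¬-fsub a (φ ∧' ψ) =
  Product.map (proj₁ (Sat¬¬-fsub a φ)) (proj₁ (Sat¬¬-fsub a ψ)) ,
  Product.map (proj₂ (Sat¬¬-fsub a φ)) (proj₂ (Sat¬¬-fsub a ψ))
Sat¬¬-fsub a (φ ∨' ψ) =
  ¬¬-map (Sum.map (proj₁ (Sat¬¬-fsub a φ)) (proj₁ (Sat¬¬-fsub a ψ))) ,
  ¬¬-map (Sum.map (proj₂ (Sat¬¬-fsub a φ)) (proj₂ (Sat¬¬-fsub a ψ)))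
Sat¬¬-fsub a (all' φ) =
  (λ f k → proj₁ (Sat¬¬-fsub (Agree-lift a k) φ) (f k)) ,
  (λ f k → proj₂ (Sat¬¬-fsub (Agree-lift a k) φ) (f k))
Sat¬¬-fsub a (ex' φ) =
  ¬¬-map (λ (k , x) → k , proj₁ (Sat¬¬-fsub (Agree-lift a k) φ) x) ,
  ¬¬-map (λ (k , x) → k , proj₂ (Sat¬¬-fsub (Agree-lift a k) φ) x)

Sat¬¬-inst : ∀ {n I} {ρ : Env n} t φ → Sat¬¬ I (ext (val ρ t) ρ) φ → Sat¬¬ I ρ (inst φ t)
Sat¬¬-inst t φ = proj₁ (Sat¬¬-fsub (Agree-single refl) φ)

Sat¬¬-uninst : ∀ {n I} {ρ : Env n} t φ → Sat¬¬ I ρ (inst φ t) → Sat¬¬ I (ext (val ρ t) ρ) φ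
Sat¬¬-uninst t φ = proj₂ (Sat¬¬-fsub (Agree-single refl) φ)

Sat¬¬-inst0-suc : ∀ {n I} {ρ : Env n} m φ →
                  Sat¬¬ I (ext m ρ) (inst0 φ (suc' (var fz))) → Sat¬¬ I (ext (suc m) ρ) φ
Sat¬¬-inst0-suc m φ = proj₂ (Sat¬¬-fsub (λ { fz → refl ; (fs i) → refl }) φ)

All-Sat¬¬-wk : ∀ {n I} {ρ : Env n} k {Γ} →
               All (Sat¬¬ I ρ) Γ → All (Sat¬¬ I (ext k ρ)) (map wk Γ)
All-Sat¬¬-wk k = map⁺ ∘ All.map (λ {φ} → proj₁ (Sat¬¬-fsub (Agree-wk k) φ))

All-¬Sat¬¬-wk : ∀ {n I} {ρ : Env n} k {Δ} →
                All (¬_ ∘ Sat¬¬ I ρ) Δ → All (¬_ ∘ Sat¬¬ I (ext k ρ)) (map wk Δ)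
All-¬Sat¬¬-wk k = map⁺ ∘ All.map (λ {φ} ¬x → ¬x ∘ proj₂ (Sat¬¬-fsub (Agree-wk k) φ))

⊢-sound : ∀ {n I} → Consistent I → {Γ Δ : List (Fm n)} → Γ ⊢ Δ → (ρ : Env n) →
          All (Sat¬¬ I ρ) Γ → ¬ All (¬_ ∘ Sat¬¬ I ρ) Δ
⊢-sound c ax ρ (x ∷ []) (¬x ∷ []) = ¬x x
⊢-sound c (wkL d) ρ (_ ∷ g) nd = ⊢-sound c d ρ g nd
⊢-sound c (wkR d) ρ g (_ ∷ nd) = ⊢-sound c d ρ g nd
⊢-sound c (ctL d) ρ (x ∷ g) nd = ⊢-sound c d ρ (x ∷ x ∷ g) nd
⊢-sound c (ctR d) ρ g (¬x ∷ nd) = ⊢-sound c d ρ g (¬x ∷ ¬x ∷ nd)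
⊢-sound c (pmL p d) ρ g nd = ⊢-sound c d ρ (All-resp-↭ (↭-sym p) g) nd
⊢-sound c (pmR p d) ρ g nd = ⊢-sound c d ρ g (All-resp-↭ (↭-sym p) nd)
⊢-sound c (cut d₁ d₂) ρ g nd = ⊢-sound c d₁ ρ g ((λ x → ⊢-sound c d₂ ρ (x ∷ g) nd) ∷ nd)
⊢-sound c exEq ρ (x ∷ ¬x ∷ []) [] = ¬x x
⊢-sound c exT ρ (x ∷ y ∷ []) [] = x (λ a → y (λ b → proj₁ c _ (a , b)))
⊢-sound c exP ρ (x ∷ y ∷ []) [] = x (λ a → y (λ b → proj₂ c _ (a , b)))
⊢-sound c emEq ρ [] (¬x ∷ ¬¬x ∷ []) = ¬¬x ¬x
⊢-sound c (∧L d) ρ ((x , y) ∷ g) nd = ⊢-sound c d ρ (x ∷ y ∷ g) nd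
⊢-sound c (∧R d₁ d₂) ρ g (¬xy ∷ nd) =
  ⊢-sound c d₁ ρ g ((λ x → ⊢-sound c d₂ ρ g ((λ y → ¬xy (x , y)) ∷ nd)) ∷ nd)
⊢-sound c (∨L d₁ d₂) ρ (x ∷ g) nd =
  x [ (λ a → ⊢-sound c d₁ ρ (a ∷ g) nd) , (λ b → ⊢-sound c d₂ ρ (b ∷ g) nd) ]
⊢-sound c (∨R d) ρ g (¬xy ∷ nd) =
  ⊢-sound c d ρ g ((¬xy ∘ contradiction ∘ inj₁) ∷ (¬xy ∘ contradiction ∘ inj₂) ∷ nd)
⊢-sound c (∀L {φ = φ} t d) ρ (f ∷ g) nd = ⊢-sound c d ρ (Sat¬¬-inst t φ (f (val ρ t)) ∷ g) nd
⊢-sound c (∃R {φ = φ} t d) ρ g (¬x ∷ nd) =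
  ⊢-sound c d ρ g ((λ x → ¬x (contradiction (val ρ t , Sat¬¬-uninst t φ x))) ∷ nd)
⊢-sound {I = I} c (∀R {φ = φ} d) ρ g (¬x ∷ nd) =
  ¬x (λ k → Sat¬¬-stable I (ext k ρ) φ
    (λ ¬y → ⊢-sound c d (ext k ρ) (All-Sat¬¬-wk k g) (¬y ∷ All-¬Sat¬¬-wk k nd)))
⊢-sound c (∃L d) ρ (x ∷ g) nd =
  x (λ (k , y) → ⊢-sound c d (ext k ρ) (y ∷ All-Sat¬¬-wk k g) (All-¬Sat¬¬-wk k nd))
⊢-sound c refl= ρ [] (¬x ∷ []) = ¬x refl
⊢-sound {I = I} c (subst= {s} {t} φ) ρ (e ∷ x ∷ []) (¬y ∷ []) =
  ¬y (Sat¬¬-inst t φ (subst (λ v → Sat¬¬ I (ext v ρ) φ) e (Sat¬¬-uninst s φ x)))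
⊢-sound c pa1 ρ (() ∷ []) []
⊢-sound c pa2 ρ (e ∷ []) (¬e ∷ []) = ¬e (suc-injective e)
⊢-sound c (pa3 {s}) ρ [] (¬e ∷ []) = ¬e (+-identityʳ (val ρ s))
⊢-sound c (pa4 {s} {t}) ρ [] (¬e ∷ []) = ¬e (+-suc (val ρ s) (val ρ t))
⊢-sound c (pa5 {s}) ρ [] (¬e ∷ []) = ¬e (*-zeroʳ (val ρ s))
⊢-sound c (pa6 {s} {t}) ρ [] (¬e ∷ []) =
  ¬e (trans (*-suc (val ρ s) (val ρ t)) (+-comm (val ρ s) (val ρ s * val ρ t)))
⊢-sound {I = I} c (ind φ t d) ρ (x ∷ g) (¬y ∷ nd) = ¬y (Sat¬¬-inst t φ (holds (val ρ t)))
  where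
  holds : ∀ m → Sat¬¬ I (ext m ρ) φ
  holds zero = Sat¬¬-uninst zer φ x
  holds (suc m) = Sat¬¬-stable I (ext (suc m) ρ) φ λ ¬z →
    ⊢-sound c d (ext m ρ) (holds m ∷ All-Sat¬¬-wk m g)
      ((¬z ∘ Sat¬¬-inst0-suc m φ) ∷ All-¬Sat¬¬-wk m nd)

⊢-sound₁ : ∀ {I ψ χ} → Consistent I → ψ ∷ [] ⊢ χ ∷ [] → I ⊨ ψ →
           DoubleNegation (Sat¬¬ I emptyEnv χ)
⊢-sound₁ {ψ = ψ} c d x ¬y = ⊢-sound c d emptyEnv (SatE⇒Sat¬¬ ψ x ∷ []) (¬y ∷ [])

⊢-sound-tr : ∀ {I ψ} (φ : Sentence) → Consistent I → ψ ∷ [] ⊢ tr ⌜ φ ⌝ ∷ [] → I ⊨ ψ →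
             DoubleNegation (T⁺ I (code φ))
⊢-sound-tr {I} φ c d x =
  subst (DoubleNegation ∘ T⁺ I) (val-num emptyEnv (code φ)) (negated-stable (⊢-sound₁ c d x))

⊢-sound-ntr : ∀ {I ψ} (φ : Sentence) → Consistent I → ψ ∷ [] ⊢ ntr ⌜ φ ⌝ ∷ [] → I ⊨ ψ →
              DoubleNegation (T⁻ I (code φ))
⊢-sound-ntr {I} φ c d x =
  subst (DoubleNegation ∘ T⁻ I) (val-num emptyEnv (code φ)) (negated-stable (⊢-sound₁ c d x))

record _⊑_ (I J : Interp) : Set where
  field
    T⁺⊆ : ∀ {k} → T⁺ I k → T⁺ J k
    T⁻⊆ : ∀ {k} → T⁻ I k → T⁻ J k
    P⁺⊆ : ∀ {k} → P⁺ I k → P⁺ J k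
    P⁻⊆ : ∀ {k} → P⁻ I k → P⁻ J k
open _⊑_

⊑-trans : ∀ {I J K} → I ⊑ J → J ⊑ K → I ⊑ K
⊑-trans v w = record
  { T⁺⊆ = T⁺⊆ w ∘ T⁺⊆ v ; T⁻⊆ = T⁻⊆ w ∘ T⁻⊆ v ; P⁺⊆ = P⁺⊆ w ∘ P⁺⊆ v ; P⁻⊆ = P⁻⊆ w ∘ P⁻⊆ v }

⊨-mono : ∀ {I J} → I ⊑ J → ∀ {n} (ρ : Env n) φ → SatE I ρ φ → SatE J ρ φ
⊨-mono w ρ (eq s t) = id
⊨-mono w ρ (neq s t) = id
⊨-mono w ρ (tr t) = T⁺⊆ w
⊨-mono w ρ (ntr t) = T⁻⊆ w
⊨-mono w ρ (pr t) = P⁺⊆ w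
⊨-mono w ρ (npr t) = P⁻⊆ w
⊨-mono w ρ (φ ∧' ψ) = Product.map (⊨-mono w ρ φ) (⊨-mono w ρ ψ)
⊨-mono w ρ (φ ∨' ψ) = Sum.map (⊨-mono w ρ φ) (⊨-mono w ρ ψ)
⊨-mono w ρ (all' φ) f k = ⊨-mono w (ext k ρ) φ (f k)
⊨-mono w ρ (ex' φ) (k , x) = k , ⊨-mono w (ext k ρ) φ x

𝒫-clause-mono : ∀ {I J} → I ⊑ J → ∀ φ → 𝒫-clause I φ → 𝒫-clause J φ
𝒫-clause-mono w (tr s) = P⁺⊆ w
𝒫-clause-mono w (ntr s) = P⁺⊆ w
𝒫-clause-mono w (ψ ∧' θ) =
  Sum.map (Product.map (P⁺⊆ w) (P⁺⊆ w))
    (Sum.map (Product.map (T⁺⊆ w) (P⁺⊆ w)) (Product.map (T⁺⊆ w) (P⁺⊆ w)))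
𝒫-clause-mono w (ψ ∨' θ) =
  Sum.map (Product.map (P⁺⊆ w) (P⁺⊆ w))
    (Sum.map (Product.map (T⁻⊆ w) (P⁺⊆ w)) (Product.map (T⁻⊆ w) (P⁺⊆ w)))
𝒫-clause-mono w (all' ψ) =
  Product.map (Product.map₂ (P⁺⊆ w)) (λ h y → Sum.map (P⁺⊆ w) (T⁺⊆ w) (h y))
𝒫-clause-mono w (ex' ψ) =
  Product.map (Product.map₂ (P⁺⊆ w)) (λ h y → Sum.map (P⁺⊆ w) (T⁻⊆ w) (h y))

ΓTP-mono : ∀ {I J} → I ⊑ J → ΓTP I ⊑ ΓTP J
ΓTP-mono w = record
  { T⁺⊆ = λ (φ , e , x) → φ , e , ⊨-mono w emptyEnv φ x
  ; T⁻⊆ = λ (φ , e , x) → φ , e , ⊨-mono w emptyEnv (neg φ) x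
  ; P⁺⊆ = λ (φ , e , x) → φ , e , Sum.map₂ (𝒫-clause-mono w φ) x
  ; P⁻⊆ = λ (φ , e , x) → φ , e , ⊨-mono w emptyEnv (φ ∨' neg φ) x }

stage-⊑-olim : ∀ (A : Set) (f : A → Ord) i → stage (f i) ⊑ stage (olim A f)
stage-⊑-olim A f i = record { T⁺⊆ = i ,_ ; T⁻⊆ = i ,_ ; P⁺⊆ = i ,_ ; P⁻⊆ = i ,_ }

olim-⊑ : ∀ (A : Set) (f : A → Ord) {J} → (∀ i → stage (f i) ⊑ J) → stage (olim A f) ⊑ J
olim-⊑ A f w = record
  { T⁺⊆ = λ (i , x) → T⁺⊆ (w i) x ; T⁻⊆ = λ (i , x) → T⁻⊆ (w i) x
  ; P⁺⊆ = λ (i , x) → P⁺⊆ (w i) x ; P⁻⊆ = λ (i , x) → P⁻⊆ (w i) x }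

stage-⊑-ΓTP : ∀ α → stage α ⊑ ΓTP (stage α)
stage-⊑-ΓTP ozero = record { T⁺⊆ = λ () ; T⁻⊆ = λ () ; P⁺⊆ = λ () ; P⁻⊆ = λ () }
stage-⊑-ΓTP (osuc α) = ΓTP-mono (stage-⊑-ΓTP α)
stage-⊑-ΓTP (olim A f) =
  olim-⊑ A f λ i → ⊑-trans (stage-⊑-ΓTP (f i)) (ΓTP-mono (stage-⊑-olim A f i))

stage-T⊆P⁻ : ∀ α {k} → T⁺ (stage α) k ⊎ T⁻ (stage α) k → P⁻ (stage α) k
stage-T⊆P⁻ ozero (inj₁ ())
stage-T⊆P⁻ ozero (inj₂ ())
stage-T⊆P⁻ (osuc α) (inj₁ (φ , e , x)) = φ , e , inj₁ x
stage-T⊆P⁻ (osuc α) (inj₂ (φ , e , x)) = φ , e , inj₂ x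
stage-T⊆P⁻ (olim A f) (inj₁ (i , x)) = i , stage-T⊆P⁻ (f i) (inj₁ x)
stage-T⊆P⁻ (olim A f) (inj₂ (i , x)) = i , stage-T⊆P⁻ (f i) (inj₂ x)

decode : ∀ (A : Sentence → Set) ψ → Σ Sentence (λ φ → code φ ≡ code ψ × A φ) → A ψ
decode A ψ (φ , e , x) = subst A (code-injective e) x

Sound : Interp → Sentence → Set
Sound I φ = Determinate I φ → ¬ Sat𝒫 I φ

module _ {u : Interp} (con : Consistent u) (u⊑Γu : u ⊑ ΓTP u)
         (T⊆P⁻ : ∀ {k} → T⁺ u k ⊎ T⁻ u k → P⁻ u k) where

  T⁺⇒true : ∀ ψ → T⁺ u (code ψ) → u ⊨ ψ
  T⁺⇒true ψ = decode (u ⊨_) ψ ∘ T⁺⊆ u⊑Γu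

  T⁻⇒false : ∀ ψ → T⁻ u (code ψ) → u ⊨ neg ψ
  T⁻⇒false ψ = decode (λ χ → u ⊨ neg χ) ψ ∘ T⁻⊆ u⊑Γu

  P⁺⇒Sat𝒫 : ∀ ψ → P⁺ u (code ψ) → Sat𝒫 u ψ
  P⁺⇒Sat𝒫 ψ = decode (Sat𝒫 u) ψ ∘ P⁺⊆ u⊑Γu

  ¬true×false : ∀ ψ → u ⊨ ψ → ¬ u ⊨ neg ψ
  ¬true×false = ⊨-consistent con emptyEnv

  true⇒¬P⁺ : ∀ ψ → Sound u ψ → u ⊨ ψ → ¬ P⁺ u (code ψ)
  true⇒¬P⁺ ψ s x = s (inj₁ x) ∘ P⁺⇒Sat𝒫 ψ

  false⇒¬P⁺ : ∀ ψ → Sound u ψ → u ⊨ neg ψ → ¬ P⁺ u (code ψ)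
  false⇒¬P⁺ ψ s x = s (inj₂ x) ∘ P⁺⇒Sat𝒫 ψ

  liar-undetermined : ∀ φ → InB φ → ¬ Determinate u φ
  liar-undetermined φ ((φ⊢¬Tφ , _) , (¬φ⊢Tφ , _)) (inj₁ ⊨φ) =
    ⊢-sound-ntr φ con φ⊢¬Tφ ⊨φ (¬true×false φ ⊨φ ∘ T⁻⇒false φ)
  liar-undetermined φ ((φ⊢¬Tφ , _) , (¬φ⊢Tφ , _)) (inj₂ ⊨¬φ) =
    ⊢-sound-tr φ con ¬φ⊢Tφ ⊨¬φ (λ Tφ → ¬true×false φ (T⁺⇒true φ Tφ) ⊨¬φ)

  Π⇒undetermined : ∀ φ → InΠ φ → ¬ Determinate u φ
  Π⇒undetermined φ (inj₁ b) = liar-undetermined φ b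
  Π⇒undetermined φ (inj₂ b) = liar-undetermined (neg φ) b ∘ Determinate-neg φ

  T-decided⇒¬P⁺ : ∀ {k} → T⁺ u k ⊎ T⁻ u k → ¬ P⁺ u k
  T-decided⇒¬P⁺ d p = proj₂ con _ (p , T⊆P⁻ d)

  ∧-sound : ∀ ψ θ → Sound u ψ → Sound u θ → Determinate u (ψ ∧' θ) → ¬ 𝒫-clause u (ψ ∧' θ)
  ∧-sound ψ θ sψ sθ (inj₁ (⊨ψ , ⊨θ)) (inj₁ (Pψ , _)) = true⇒¬P⁺ ψ sψ ⊨ψ Pψ
  ∧-sound ψ θ sψ sθ (inj₁ (⊨ψ , ⊨θ)) (inj₂ (inj₁ (_ , Pθ))) = true⇒¬P⁺ θ sθ ⊨θ Pθ
  ∧-sound ψ θ sψ sθ (inj₁ (⊨ψ , ⊨θ)) (inj₂ (inj₂ (_ , Pψ))) = true⇒¬P⁺ ψ sψ ⊨ψ Pψ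
  ∧-sound ψ θ sψ sθ (inj₂ (inj₁ ⊨¬ψ)) (inj₁ (Pψ , _)) = false⇒¬P⁺ ψ sψ ⊨¬ψ Pψ
  ∧-sound ψ θ sψ sθ (inj₂ (inj₁ ⊨¬ψ)) (inj₂ (inj₁ (Tψ , _))) = ¬true×false ψ (T⁺⇒true ψ Tψ) ⊨¬ψ
  ∧-sound ψ θ sψ sθ (inj₂ (inj₁ ⊨¬ψ)) (inj₂ (inj₂ (_ , Pψ))) = false⇒¬P⁺ ψ sψ ⊨¬ψ Pψ
  ∧-sound ψ θ sψ sθ (inj₂ (inj₂ ⊨¬θ)) (inj₁ (_ , Pθ)) = false⇒¬P⁺ θ sθ ⊨¬θ Pθ
  ∧-sound ψ θ sψ sθ (inj₂ (inj₂ ⊨¬θ)) (inj₂ (inj₁ (_ , Pθ))) = false⇒¬P⁺ θ sθ ⊨¬θ Pθ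
  ∧-sound ψ θ sψ sθ (inj₂ (inj₂ ⊨¬θ)) (inj₂ (inj₂ (Tθ , _))) = ¬true×false θ (T⁺⇒true θ Tθ) ⊨¬θ

  ∨-sound : ∀ ψ θ → Sound u ψ → Sound u θ → Determinate u (ψ ∨' θ) → ¬ 𝒫-clause u (ψ ∨' θ)
  ∨-sound ψ θ sψ sθ (inj₁ (inj₁ ⊨ψ)) (inj₁ (Pψ , _)) = true⇒¬P⁺ ψ sψ ⊨ψ Pψ
  ∨-sound ψ θ sψ sθ (inj₁ (inj₁ ⊨ψ)) (inj₂ (inj₁ (Fψ , _))) = ¬true×false ψ ⊨ψ (T⁻⇒false ψ Fψ)
  ∨-sound ψ θ sψ sθ (inj₁ (inj₁ ⊨ψ)) (inj₂ (inj₂ (_ , Pψ))) = true⇒¬P⁺ ψ sψ ⊨ψ Pψ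
  ∨-sound ψ θ sψ sθ (inj₁ (inj₂ ⊨θ)) (inj₁ (_ , Pθ)) = true⇒¬P⁺ θ sθ ⊨θ Pθ
  ∨-sound ψ θ sψ sθ (inj₁ (inj₂ ⊨θ)) (inj₂ (inj₁ (_ , Pθ))) = true⇒¬P⁺ θ sθ ⊨θ Pθ
  ∨-sound ψ θ sψ sθ (inj₁ (inj₂ ⊨θ)) (inj₂ (inj₂ (Fθ , _))) = ¬true×false θ ⊨θ (T⁻⇒false θ Fθ)
  ∨-sound ψ θ sψ sθ (inj₂ (⊨¬ψ , ⊨¬θ)) (inj₁ (Pψ , _)) = false⇒¬P⁺ ψ sψ ⊨¬ψ Pψ
  ∨-sound ψ θ sψ sθ (inj₂ (⊨¬ψ , ⊨¬θ)) (inj₂ (inj₁ (_ , Pθ))) = false⇒¬P⁺ θ sθ ⊨¬θ Pθ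
  ∨-sound ψ θ sψ sθ (inj₂ (⊨¬ψ , ⊨¬θ)) (inj₂ (inj₂ (_ , Pψ))) = false⇒¬P⁺ ψ sψ ⊨¬ψ Pψ

  ∀-sound : ∀ ψ → (∀ y → Sound u (ψ ⟨ y ⟩)) → Determinate u (all' ψ) → ¬ 𝒫-clause u (all' ψ)
  ∀-sound ψ s (inj₁ ⊨ψ) ((y , Py) , _) = true⇒¬P⁺ (ψ ⟨ y ⟩) (s y) (⊨-inst ψ y (⊨ψ y)) Py
  ∀-sound ψ s (inj₂ (y , ⊨¬ψy)) (_ , P∨T) with P∨T y
  ... | inj₁ Py = false⇒¬P⁺ (ψ ⟨ y ⟩) (s y) (⊨-inst-neg ψ y ⊨¬ψy) Py
  ... | inj₂ Ty = ¬true×false (ψ ⟨ y ⟩) (T⁺⇒true (ψ ⟨ y ⟩) Ty) (⊨-inst-neg ψ y ⊨¬ψy)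

  ∃-sound : ∀ ψ → (∀ y → Sound u (ψ ⟨ y ⟩)) → Determinate u (ex' ψ) → ¬ 𝒫-clause u (ex' ψ)
  ∃-sound ψ s (inj₂ ⊨¬ψ) ((y , Py) , _) =
    false⇒¬P⁺ (ψ ⟨ y ⟩) (s y) (⊨-inst-neg ψ y (⊨¬ψ y)) Py
  ∃-sound ψ s (inj₁ (y , ⊨ψy)) (_ , P∨F) with P∨F y
  ... | inj₁ Py = true⇒¬P⁺ (ψ ⟨ y ⟩) (s y) (⊨-inst ψ y ⊨ψy) Py
  ... | inj₂ Fy = ¬true×false (ψ ⟨ y ⟩) (⊨-inst ψ y ⊨ψy) (T⁻⇒false (ψ ⟨ y ⟩) Fy)

  sound : ∀ φ → Acc _<_ (size φ) → Sound u φ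
  sound φ _ d (inj₁ π) = Π⇒undetermined φ π d
  sound (tr t) _ d (inj₂ p) = T-decided⇒¬P⁺ d p
  sound (ntr t) _ d (inj₂ p) = T-decided⇒¬P⁺ (Sum.swap d) p
  sound (ψ ∧' θ) (acc rs) d (inj₂ p) =
    ∧-sound ψ θ (sound ψ (rs (size<ˡ ψ θ))) (sound θ (rs (size<ʳ ψ θ))) d p
  sound (ψ ∨' θ) (acc rs) d (inj₂ p) =
    ∨-sound ψ θ (sound ψ (rs (size<ˡ ψ θ))) (sound θ (rs (size<ʳ ψ θ))) d p
  sound (all' ψ) (acc rs) d (inj₂ p) = ∀-sound ψ (λ y → sound (ψ ⟨ y ⟩) (rs (size-inst< ψ y))) d p
  sound (ex' ψ) (acc rs) d (inj₂ p) = ∃-sound ψ (λ y → sound (ψ ⟨ y ⟩) (rs (size-inst< ψ y))) d p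

mainTheorem8 : (α : Ord) → Consistent (stage α) →
    (φ : Sentence) → ¬ ((stage α ⊨ (φ ∨' neg φ)) × Sat𝒫 (stage α) φ)
mainTheorem8 α con φ (d , p) =
  sound con (stage-⊑-ΓTP α) (stage-T⊆P⁻ α) φ (<-wellFounded (size φ)) d p
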